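{- There is a co-meager semifilter on $\omega$ with the Ramsey property that is not countably Ramsey.
   Context: For $A,B\subseteq\omega$, $A\subseteq^* B$ means $A\setminus B$ is finite. A semifilter on $\omega$ is a set $\mathcal S\subseteq\mathcal P(\omega)$ with $\emptyset\neq\mathcal S\neq\mathcal P(\omega)$ closed upwards under $\subseteq^*$; subsets of $\omega$ are identified with points of $2^\omega$ and co-meager refers to that topology. $\mathcal S$ has the Ramsey property if whenever $A\in\mathcal S$ and $A=\bigcup_{i\le n}A_i$, some $A_i\in\mathcal S$. $\mathcal S$ is countably Ramsey if whenever $A\in\mathcal S$ and $A=\bigcup_{n\in\omega}A_n$, either some $A_n\in\mathcal S$, or there is $B\subseteq A$ with $B\in\mathcal S$ and $B\cap A_n$ finite for every $n$. -}

module Defs where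

open import Data.Nat using (ℕ; zero; suc; _≤_)
open import Data.Bool using (Bool; true; false)
open import Data.Fin using (Fin)
open import Data.List using (List; []; _∷_; _++_)
open import Data.Product using (Σ; ∃; ∃-syntax; _×_; _,_)
open import Data.Sum using (_⊎_)
open import Relation.Nullary using (¬_)
open import Relation.Binary.PropositionalEquality using (_≡_)

-- Subsets of ω are points of Cantor space 2^ω : characteristic functions.
Subset : Set
Subset = ℕ → Bool

_∈ₛ_ : ℕ → Subset → Set
n ∈ₛ A = A n ≡ true

Family : Set₁
Family = Subset → Set

Finite : Subset → Set
Finite X = ∃[ N ] (∀ n → N ≤ n → X n ≡ false)

_∖_ : Subset → Subset → Subset
(A ∖ B) n with A n | B n
... | true | false = true
... | _    | _     = false

_∩_ : Subset → Subset → Subset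
(A ∩ B) n with A n
... | true = B n
... | false = false

_⊆*_ : Subset → Subset → Set
A ⊆* B = Finite (A ∖ B)

_⊆_ : Subset → Subset → Set
A ⊆ B = ∀ n → n ∈ₛ A → n ∈ₛ B

emptySet : Subset
emptySet _ = false

IsSemifilter : Family → Set
IsSemifilter S =
  (∃[ A ] S A) ×
  (∃[ A ] ¬ S A) ×
  (∀ A B → S A → A ⊆* B → S B)

IsUnionOf : {I : Set} → Subset → (I → Subset) → Set
IsUnionOf {I} A As =
  (∀ m → m ∈ₛ A → ∃[ i ] (m ∈ₛ As i)) ×
  (∀ (i : I) m → m ∈ₛ As i → m ∈ₛ A)

RamseyProperty : Family → Set
RamseyProperty S =
  ∀ A (n : ℕ) (As : Fin (suc n) → Subset) →
  S A → IsUnionOf A As → ∃[ i ] S (As i)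

CountablyRamsey : Family → Set
CountablyRamsey S =
  ∀ A (As : ℕ → Subset) →
  S A → IsUnionOf A As →
  (∃[ n ] S (As n)) ⊎
  (∃[ B ] (B ⊆ A × S B × (∀ n → Finite (B ∩ As n))))

-- Topology of 2^ω: basic clopen sets [s] for finite binary strings s.
prefix : Subset → ℕ → List Bool
prefix x zero = []
prefix x (suc k) = x zero ∷ prefix (λ n → x (suc n)) k

-- An open set given by a set W of strings: U_W = ⋃_{s ∈ W} [s].
InOpen : (List Bool → Set) → Subset → Set
InOpen W x = ∃[ k ] W (prefix x k)

-- U_W is dense: every basic open set [s] meets U_W, i.e. some extension of s is in W
-- (then [t] ⊆ [s] ∩ U_W); conversely density gives such t.
DenseOpen : (List Bool → Set) → Set
DenseOpen W = ∀ s → ∃[ u ] W (s ++ u)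

-- S is co-meager: it contains a countable intersection of dense open sets.
-- (Every open set of 2^ω is of the form U_W.)
CoMeager : Family → Set₁
CoMeager S =
  Σ (ℕ → List Bool → Set) λ W →
    (∀ n → DenseOpen (W n)) ×
    (∀ x → (∀ n → InOpen (W n) x) → S x)

LEM : Set₁
LEM = (P : Set) → P ⊎ ¬ P

module Submission where

-- Split ω into infinitely many infinite columns C₀, C₁, … using the triangular
-- enumeration of ℕ × ℕ: the j-th element of column n is  pos n j = tri (j + n) + n.
-- The semifilter is
--     S = { X ⊆ ω | X ∩ Cₙ is infinite for infinitely many n }.
-- * S is a semifilter: it contains ω, misses ∅, and a finite modification of X
--   does not affect the infinitude of any X ∩ Cₙ.
-- * S is co-meager: it contains the intersection of the dense open sets
--   Wₖ = { X | ∃ j ≥ k, pos n j ∈ X for all n ≤ k }.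
-- * S is Ramsey: "infinitely many" is partition regular (a classical pigeonhole
--   principle, which is where LEM enters), applied once inside each column and
--   once to the set of columns.
-- * S is not countably Ramsey: ω = ⋃ₙ Cₙ, no single column is in S, and every
--   B ∈ S meets some column in an infinite set.

open import Defs
open import Data.Product using (Σ; _×_)
open import Relation.Nullary using (¬_)

open import Data.Nat using (ℕ; zero; suc; _+_; _≤_; _<_; z≤n; s≤s; _⊔_)
open import Data.Nat.Properties
open import Data.Bool using (Bool; true; false; if_then_else_)
open import Data.Fin using (Fin)
import Data.Fin as Fin
open import Data.List using (List; []; _∷_; _++_; length; replicate)
open import Data.Product using (∃-syntax; _,_; proj₂)
open import Data.Sum using (_⊎_; inj₁; inj₂)
open import Data.Empty using (⊥-elim)
open import Relation.Nullary using (Dec; does; yes; no)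
open import Relation.Nullary.Decidable using (dec-true; dec-false)
open import Relation.Binary.PropositionalEquality
  using (_≡_; refl; sym; trans; cong; module ≡-Reasoning)

Inf : (ℕ → Set) → Set
Inf P = ∀ N → ∃[ j ] (N ≤ j × P j)

Inf-map : {P Q : ℕ → Set} → (∀ j → P j → Q j) → Inf P → Inf Q
Inf-map f inf N with inf N
... | j , N≤j , p = j , N≤j , f j p

¬Inf⇒eventually¬ : LEM → {P : ℕ → Set} → ¬ Inf P → ∃[ N ] (∀ j → N ≤ j → ¬ P j)
¬Inf⇒eventually¬ lem {P} ¬inf with lem (∃[ N ] (∀ j → N ≤ j → ¬ P j))
... | inj₁ eventually = eventually
... | inj₂ ¬eventually = ⊥-elim (¬inf beyond)
  where
  beyond : Inf P
  beyond N with lem (∃[ j ] (N ≤ j × P j))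
  ... | inj₁ witness = witness
  ... | inj₂ none = ⊥-elim (¬eventually (N , λ j N≤j p → none (j , N≤j , p)))

Inf-⊎ : LEM → {P Q : ℕ → Set} → Inf (λ j → P j ⊎ Q j) → Inf P ⊎ Inf Q
Inf-⊎ lem {P} {Q} inf with lem (Inf P)
... | inj₁ infP = inj₁ infP
... | inj₂ ¬infP with ¬Inf⇒eventually¬ lem ¬infP
... | N , ¬P = inj₂ infQ
  where
  infQ : Inf Q
  infQ M with inf (M ⊔ N)
  ... | j , le , inj₁ p = ⊥-elim (¬P j (≤-trans (m≤n⊔m M N) le) p)
  ... | j , le , inj₂ q = j , ≤-trans (m≤m⊔n M N) le , q

Inf-pigeonhole : LEM → (k : ℕ) → {Q : Fin (suc k) → ℕ → Set} →
  Inf (λ j → ∃[ i ] Q i j) → ∃[ i ] Inf (Q i)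
Inf-pigeonhole lem zero {Q} inf = Fin.zero , Inf-map only inf
  where
  only : ∀ j → ∃[ i ] Q i j → Q Fin.zero j
  only j (Fin.zero , q) = q
Inf-pigeonhole lem (suc k) {Q} inf with Inf-⊎ lem (Inf-map headOrTail inf)
  where
  headOrTail : ∀ j → ∃[ i ] Q i j → Q Fin.zero j ⊎ ∃[ i ] Q (Fin.suc i) j
  headOrTail j (Fin.zero , q) = inj₁ q
  headOrTail j (Fin.suc i , q) = inj₂ (i , q)
... | inj₁ infHead = Fin.zero , infHead
... | inj₂ infTail with Inf-pigeonhole lem k {λ i → Q (Fin.suc i)} infTail
... | i , infQi = Fin.suc i , infQi

-- tri d = 1 + 2 + … + d is the first number on the d-th diagonal.
tri : ℕ → ℕ
tri zero = zero
tri (suc d) = suc d + tri d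

-- Walking along the diagonals: (d , i) stands for tri d + i, with i ≤ d.
next : ℕ × ℕ → ℕ × ℕ
next (d , i) = if does (i ≟ d) then (suc d , 0) else (d , suc i)

unpair : ℕ → ℕ × ℕ
unpair zero = 0 , 0
unpair (suc m) = next (unpair m)

next-last : ∀ d → next (d , d) ≡ (suc d , 0)
next-last d = cong (λ b → if b then (suc d , 0) else (d , suc d)) (dec-true (d ≟ d) refl)

next-inner : ∀ {d i} → i < d → next (d , i) ≡ (d , suc i)
next-inner {d} {i} i<d =
  cong (λ b → if b then (suc d , 0) else (d , suc i)) (dec-false (i ≟ d) (<⇒≢ i<d))

unpair-diag : ∀ d i → i ≤ d → unpair (tri d + i) ≡ (d , i)
unpair-diag zero zero _ = refl
unpair-diag (suc d) zero _ = begin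
  unpair (tri (suc d) + 0)  ≡⟨ cong unpair (trans (+-identityʳ (tri (suc d))) (cong suc (+-comm d (tri d)))) ⟩
  next (unpair (tri d + d)) ≡⟨ cong next (unpair-diag d d ≤-refl) ⟩
  next (d , d)              ≡⟨ next-last d ⟩
  (suc d , 0)               ∎
  where open ≡-Reasoning
unpair-diag d (suc i) i<d = begin
  unpair (tri d + suc i)    ≡⟨ cong unpair (+-suc (tri d) i) ⟩
  next (unpair (tri d + i)) ≡⟨ cong next (unpair-diag d i (<⇒≤ i<d)) ⟩
  next (d , i)              ≡⟨ next-inner i<d ⟩
  (d , suc i)               ∎
  where open ≡-Reasoning

col : ℕ → ℕ
col m = proj₂ (unpair m)

pos : ℕ → ℕ → ℕ
pos n j = tri (j + n) + n

col-pos : ∀ n j → col (pos n j) ≡ n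
col-pos n j = cong proj₂ (unpair-diag (j + n) n (m≤n+m n j))

d≤tri : ∀ d → d ≤ tri d
d≤tri zero = z≤n
d≤tri (suc d) = m≤m+n (suc d) (tri d)

tri-mono : ∀ {a b} → a ≤ b → tri a ≤ tri b
tri-mono z≤n = z≤n
tri-mono (s≤s a≤b) = +-mono-≤ (s≤s a≤b) (tri-mono a≤b)

j≤pos : ∀ n j → j ≤ pos n j
j≤pos n j = ≤-trans (m≤m+n j n) (≤-trans (d≤tri (j + n)) (m≤m+n (tri (j + n)) n))

pos-monoˡ : ∀ {n k} j → n ≤ k → pos n j ≤ pos k j
pos-monoˡ j n≤k = +-mono-≤ (tri-mono (+-monoʳ-≤ j n≤k)) n≤k

column : ℕ → Subset
column n m = does (col m ≟ n)

pos∈column : ∀ n j → pos n j ∈ₛ column n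
pos∈column n j = dec-true (col (pos n j) ≟ n) (col-pos n j)

column-col : ∀ m {n} → m ∈ₛ column n → col m ≡ n
column-col m {n} mem = witness (col m ≟ n) mem
  where
  witness : ∀ {A : Set} (a? : Dec A) → does a? ≡ true → A
  witness (yes a) _ = a
  witness (no _) ()

pos∈column⇒≡ : ∀ {k n} j → pos k j ∈ₛ column n → k ≡ n
pos∈column⇒≡ {k} j mem = trans (sym (col-pos k j)) (column-col (pos k j) mem)

ColumnInfinite : Subset → ℕ → Set
ColumnInfinite X n = Inf (λ j → pos n j ∈ₛ X)

S : Family
S X = Inf (ColumnInfinite X)

full : Subset
full _ = true

full∈S : S full
full∈S N = N , ≤-refl , λ M → M , ≤-refl , refl

∅∉S : ¬ S emptySet
∅∉S ∅∈S with ∅∈S 0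
... | n , _ , infinite with infinite 0
... | _ , _ , ()

ColumnInfinite⇒¬Finite : ∀ {X n} → ColumnInfinite X n → ¬ Finite X
ColumnInfinite⇒¬Finite {X} {n} infinite (N , beyond) with infinite N
... | j , N≤j , mem with trans (sym mem) (beyond (pos n j) (≤-trans N≤j (j≤pos n j)))
... | ()

∖-elim : ∀ A B {m} → m ∈ₛ A → (A ∖ B) m ≡ false → m ∈ₛ B
∖-elim A B {m} m∈A m∉A∖B with A m | B m
... | true | true = refl
∖-elim A B {m} refl () | true | false

∩-intro : ∀ A B {m} → m ∈ₛ A → m ∈ₛ B → m ∈ₛ (A ∩ B)
∩-intro A B {m} m∈A m∈B with A m
∩-intro A B {m} refl m∈B | true = m∈B

ColumnInfinite-⊆* : ∀ {A B} → A ⊆* B → ∀ n → ColumnInfinite A n → ColumnInfinite B n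
ColumnInfinite-⊆* {A} {B} (N , almost) n infinite M with infinite (M ⊔ N)
... | j , le , mem = j , ≤-trans (m≤m⊔n M N) le ,
  ∖-elim A B mem (almost (pos n j) (≤-trans (m≤n⊔m M N) (≤-trans le (j≤pos n j))))

S-semifilter : IsSemifilter S
S-semifilter = (full , full∈S) , (emptySet , ∅∉S) ,
  λ A B A∈S A⊆*B → Inf-map (ColumnInfinite-⊆* A⊆*B) A∈S

-- The p-th bit of a finite string (false beyond its end).
bit : List Bool → ℕ → Bool
bit [] _ = false
bit (b ∷ _) zero = b
bit (_ ∷ s) (suc p) = bit s p

W : ℕ → List Bool → Set
W k s = ∃[ j ] (k ≤ j × (∀ n → n ≤ k → bit s (pos n j) ≡ true))

bit-prefix : ∀ x len p → bit (prefix x len) p ≡ true → p ∈ₛ x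
bit-prefix x zero p ()
bit-prefix x (suc len) zero b = b
bit-prefix x (suc len) (suc p) b = bit-prefix (λ n → x (suc n)) len p b

bit-padded : ∀ s L p → length s ≤ p → p < length s + L → bit (s ++ replicate L true) p ≡ true
bit-padded [] (suc L) zero _ _ = refl
bit-padded [] (suc L) (suc p) _ (s≤s p<L) = bit-padded [] L p z≤n p<L
bit-padded (_ ∷ s) L (suc p) (s≤s le) (s≤s lt) = bit-padded s L p le lt

W-dense : ∀ k → DenseOpen (W k)
W-dense k s = replicate (suc (pos k j)) true , j , m≤m+n k (length s) , hit
  where
  j = k + length s
  hit : ∀ n → n ≤ k → bit (s ++ replicate (suc (pos k j)) true) (pos n j) ≡ true
  hit n n≤k = bit-padded s (suc (pos k j)) (pos n j)
    (≤-trans (m≤n+m (length s) k) (j≤pos n j))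
    (≤-trans (s≤s (pos-monoˡ j n≤k)) (m≤n+m (suc (pos k j)) (length s)))

⋂W⊆S : ∀ x → (∀ k → InOpen (W k) x) → S x
⋂W⊆S x inW N = N , ≤-refl , λ M → height M
  where
  height : ∀ M → ∃[ j ] (M ≤ j × pos N j ∈ₛ x)
  height M with inW (N + M)
  ... | len , j , N+M≤j , hits = j , ≤-trans (m≤n+m M N) N+M≤j ,
    bit-prefix x len (pos N j) (hits N (m≤m+n N M))

S-comeager : CoMeager S
S-comeager = W , W-dense , ⋂W⊆S

-- Pigeonhole inside each infinite column, then over the infinitely many columns.
S-Ramsey : LEM → RamseyProperty S
S-Ramsey lem A k As A∈S (covered , _) =
  Inf-pigeonhole lem k (Inf-map splitColumn A∈S)
  where
  splitColumn : ∀ n → ColumnInfinite A n → ∃[ i ] ColumnInfinite (As i) n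
  splitColumn n infinite =
    Inf-pigeonhole lem k (Inf-map (λ j mem → covered (pos n j) mem) infinite)

columns-cover : IsUnionOf full column
columns-cover = (λ m _ → col m , dec-true (col m ≟ col m) refl) , λ _ _ _ → refl

-- A single column meets no other column at all.
column∉S : ∀ n → ¬ S (column n)
column∉S n column∈S with column∈S (suc n)
... | k , n<k , infinite with infinite 0
... | j , _ , mem = <-irrefl (sym (pos∈column⇒≡ j mem)) n<k

-- Some column of B ∈ S is infinite inside B, hence inside B ∩ Cₙ.
S-¬almostDisjoint : ∀ B → S B → ¬ (∀ n → Finite (B ∩ column n))
S-¬almostDisjoint B B∈S finite with B∈S 0
... | n , _ , infinite = ColumnInfinite⇒¬Finite
  (Inf-map (λ j mem → ∩-intro B (column n) mem (pos∈column n j)) infinite) (finite n)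

S-¬countablyRamsey : ¬ CountablyRamsey S
S-¬countablyRamsey countablyRamsey
  with countablyRamsey full column full∈S columns-cover
... | inj₁ (n , column∈S) = column∉S n column∈S
... | inj₂ (B , _ , B∈S , almostDisjoint) = S-¬almostDisjoint B B∈S almostDisjoint

corollary6p8 : LEM →
    Σ Family λ S →
      IsSemifilter S × CoMeager S × RamseyProperty S × ¬ CountablyRamsey S
corollary6p8 lem = S , S-semifilter , S-comeager , S-Ramsey lem , S-¬countablyRamsey
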